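{- Let $\mathbf L$ be a Latin square of order $n$ and let $t$ be the maximum number of pairwise disjoint transversals of $\mathbf L$. If $t\le n-2$, then $\chi(\mathbf L)\le 3n-2t-2$; otherwise $\chi(\mathbf L)=n$.
   Context: A Latin square $\mathbf L$ of order $n$ is an $n\times n$ array whose cells each contain one of $n$ symbols, with no symbol repeated in any row or column. A partial transversal is a set of cells no two of which share a row, a column, or a symbol; a transversal is a partial transversal with $n$ cells. $\chi(\mathbf L)$ is the minimum number of partial transversals of $\mathbf L$ that together cover all cells of $\mathbf L$. -}

module Defs where

open import Data.Nat using (ℕ; _≤_)
open import Data.Fin using (Fin)
open import Data.Product using (_×_; _,_; proj₁; proj₂; Σ; ∃)
open import Data.List using (List; length; map)
open import Data.List.Membership.Propositional using (_∈_)
open import Data.List.Relation.Unary.Unique.Propositional using (Unique)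
open import Data.List.Relation.Unary.All using (All)
open import Data.List.Relation.Unary.Any using (Any)
open import Data.List.Relation.Unary.AllPairs using (AllPairs)
open import Function.Definitions using (Injective)
open import Relation.Binary.PropositionalEquality using (_≡_)
open import Relation.Nullary using (¬_)

record LatinSquare (n : ℕ) : Set where
  field
    entry   : Fin n → Fin n → Fin n
    rowInj  : ∀ r → Injective _≡_ _≡_ (entry r)
    colInj  : ∀ c → Injective _≡_ _≡_ (λ r → entry r c)
open LatinSquare public

Cell : ℕ → Set
Cell n = Fin n × Fin n

row : ∀ {n} → Cell n → Fin n
row = proj₁

col : ∀ {n} → Cell n → Fin n
col = proj₂

symbol : ∀ {n} → LatinSquare n → Cell n → Fin n
symbol L (r , c) = entry L r c

-- A partial transversal: a set (given as a list) of cells, no two sharing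
-- a row, a column or a symbol. (Distinct rows already forces distinct cells.)
IsPartialTransversal : ∀ {n} → LatinSquare n → List (Cell n) → Set
IsPartialTransversal L T =
  Unique (map row T) × Unique (map col T) × Unique (map (symbol L) T)

IsTransversal : ∀ {n} → LatinSquare n → List (Cell n) → Set
IsTransversal {n} L T = IsPartialTransversal L T × length T ≡ n

Disjoint : ∀ {n} → List (Cell n) → List (Cell n) → Set
Disjoint S T = ∀ x → x ∈ S → ¬ (x ∈ T)

HasDisjointTransversals : ∀ {n} → LatinSquare n → ℕ → Set
HasDisjointTransversals {n} L k =
  Σ (List (List (Cell n))) λ Ts →
    length Ts ≡ k × All (IsTransversal L) Ts × AllPairs Disjoint Ts

IsMaxDisjointTransversals : ∀ {n} → LatinSquare n → ℕ → Set
IsMaxDisjointTransversals L t =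
  HasDisjointTransversals L t × (∀ k → HasDisjointTransversals L k → k ≤ t)

CoverableBy : ∀ {n} → LatinSquare n → ℕ → Set
CoverableBy {n} L k =
  Σ (List (List (Cell n))) λ Ts →
    length Ts ≡ k × All (IsPartialTransversal L) Ts ×
    (∀ (x : Cell n) → Any (x ∈_) Ts)

IsChi : ∀ {n} → LatinSquare n → ℕ → Set
IsChi L c = CoverableBy L c × (∀ k → CoverableBy L k → c ≤ k)

-- Fix t disjoint transversals. An uncovered cell shares its row with exactly one cell of each
-- of them, so at most n − 1 − t other uncovered cells lie in its row, and likewise for its column
-- and its symbol. Greedily colouring the uncovered cells, so that no two cells of one colour share
-- a line, needs at most 3(n − 1 − t) + 1 colours, and each colour class is a partial transversal:
-- χ ≤ t + 3(n − 1 − t) + 1 = 3n − 2t − 2. If t ≥ n − 1, the same construction with n − 1 of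
-- the transversals gives χ ≤ n, while χ ≥ n since the cells of a row need distinct partial
-- transversals.

module Submission where

open import Defs
open import Data.Nat using (ℕ; _≤_; _+_; _*_; _∸_)
open import Data.Product using (_×_)
open import Relation.Binary.PropositionalEquality using (_≡_)
open import Relation.Nullary using (¬_)

open import Data.Nat using (zero; suc; _<_; z≤n; s≤s)
open import Data.Nat.Properties
open import Data.Nat.Tactic.RingSolver using (solve-∀)
open import Data.Fin using (Fin; zero; suc)
open import Data.Fin.Properties using (injective⇒≤; all?; ¬∀⟶∃¬) renaming (_≟_ to _≟ᶠ_)
open import Data.Product using (_,_; proj₁; proj₂; Σ; ∃)
open import Data.Product.Properties using (≡-dec; ×-≡,≡→≡)
open import Data.Sum using (_⊎_; inj₁; inj₂)
open import Data.List
  using (List; []; _∷_; length; map; filter; lookup; take; tabulate; allFin; cartesianProduct; _++_)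
open import Data.List.Properties using (length-map; length-++; length-tabulate; length-take)
open import Data.List.Membership.Propositional using (_∈_; _∉_)
open import Data.List.Membership.Propositional.Properties
  using (∈-lookup; ∈-map⁺; ∈-map⁻; ∈-filter⁺; ∈-filter⁻; ∈-cartesianProduct⁺; ∈-allFin)
import Data.List.Membership.Setoid.Properties as SetoidMembership
import Data.List.Membership.DecPropositional as DecMembership
open import Data.List.Relation.Unary.All as All using (All; []; _∷_)
import Data.List.Relation.Unary.All.Properties as All
open import Data.List.Relation.Unary.Any as Any using (Any; here; there)
import Data.List.Relation.Unary.Any.Properties as Any
open import Data.List.Relation.Unary.AllPairs as AllPairs using (AllPairs; []; _∷_)
import Data.List.Relation.Unary.AllPairs.Properties as AllPairs
open import Data.List.Relation.Unary.Unique.Propositional using (Unique)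
import Data.List.Relation.Unary.Unique.Propositional.Properties as Unique
open import Data.Empty using (⊥-elim)
open import Function using (_∘_)
open import Function.Definitions using (Injective)
open import Level using (0ℓ)
open import Relation.Binary using (Rel)
open import Relation.Binary.Definitions using (DecidableEquality) renaming (Decidable to Decidable₂)
open import Relation.Binary.PropositionalEquality
  using (refl; sym; trans; cong; subst; _≢_; setoid; module ≡-Reasoning)
open import Relation.Nullary using (yes; no; ¬?; contradiction)
open import Relation.Nullary.Decidable using (_×-dec_; _⊎-dec_)
open import Relation.Unary using (Pred; Decidable; _⊆_; _∪_; ∁)
open import Relation.Unary.Properties using (∁?)

private variable
  A : Set
  n k a b : ℕ
  P Q : Pred A 0ℓ

Unique⇒lookup-injective : {xs : List A} → Unique xs → Injective _≡_ _≡_ (lookup xs)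
Unique⇒lookup-injective (_ ∷ _)    {zero}  {zero}  _ = refl
Unique⇒lookup-injective (x∉ ∷ _)   {zero}  {suc j} e = ⊥-elim (All.lookup x∉ (∈-lookup j) e)
Unique⇒lookup-injective (x∉ ∷ _)   {suc i} {zero}  e = ⊥-elim (All.lookup x∉ (∈-lookup i) (sym e))
Unique⇒lookup-injective (_ ∷ uniq) {suc i} {suc j} e = cong suc (Unique⇒lookup-injective uniq e)

Unique⇒length≤ : {xs : List (Fin n)} → Unique xs → length xs ≤ n
Unique⇒length≤ uniq = injective⇒≤ (Unique⇒lookup-injective uniq)

Unique∧length≡⇒∈ : {xs : List (Fin n)} → Unique xs → length xs ≡ n → ∀ v → v ∈ xs
Unique∧length≡⇒∈ {n} {xs} uniq |xs|≡n v with DecMembership._∈?_ _≟ᶠ_ v xs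
... | yes v∈xs = v∈xs
... | no v∉xs  = contradiction
      (subst (λ l → suc l ≤ n) |xs|≡n (Unique⇒length≤ (All.¬Any⇒All¬ xs v∉xs ∷ uniq))) 1+n≰n

∃∉ : (ys : List (Fin k)) → length ys < k → ∃ λ c → c ∉ ys
∃∉ {k} ys |ys|<k with all? (λ c → DecMembership._∈?_ _≟ᶠ_ c ys)
... | no ¬all = ¬∀⟶∃¬ k (_∈ ys) (λ c → DecMembership._∈?_ _≟ᶠ_ c ys) ¬all
... | yes all = contradiction (injective⇒≤ index-injective) (<⇒≱ |ys|<k)
  where
    index-injective : Injective _≡_ _≡_ (λ c → Any.index (all c))
    index-injective {c} {c′} = SetoidMembership.index-injective (setoid _) (all c) (all c′)

Unique-map⇒injectiveOn : {B : Set} {f : A → B} {xs : List A} {x y : A} →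
  Unique (map f xs) → x ∈ xs → y ∈ xs → f x ≡ f y → x ≡ y
Unique-map⇒injectiveOn _ (here refl) (here refl) _ = refl
Unique-map⇒injectiveOn {f = f} (fx∉ ∷ _) (here refl) (there y∈) e =
  ⊥-elim (All.lookup fx∉ (∈-map⁺ f y∈) e)
Unique-map⇒injectiveOn {f = f} (fy∉ ∷ _) (there x∈) (here refl) e =
  ⊥-elim (All.lookup fy∉ (∈-map⁺ f x∈) (sym e))
Unique-map⇒injectiveOn (_ ∷ uniq) (there x∈) (there y∈) e = Unique-map⇒injectiveOn uniq x∈ y∈ e

AllPairs-mapWith : {R S : Rel A 0ℓ} {xs : List A} → (∀ {x y} → P x → P y → R x y → S x y) →
  All P xs → AllPairs R xs → AllPairs S xs
AllPairs-mapWith f []         []         = []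
AllPairs-mapWith f (px ∷ pxs) (rx ∷ rxs) =
  All.zipWith (λ (py , r) → f px py r) (pxs , rx) ∷ AllPairs-mapWith f pxs rxs

length-filter+length-filter-∁ : (P? : Decidable P) (xs : List A) →
  length (filter P? xs) + length (filter (∁? P?) xs) ≡ length xs
length-filter+length-filter-∁ P? [] = refl
length-filter+length-filter-∁ P? (x ∷ xs) with P? x
... | yes _ = cong suc (length-filter+length-filter-∁ P? xs)
... | no  _ = trans (+-suc _ _) (cong suc (length-filter+length-filter-∁ P? xs))

AtMost : ℕ → Pred A 0ℓ → Set
AtMost {A} k P = ∀ {xs : List A} → Unique xs → All P xs → length xs ≤ k

AtMost-mono : P ⊆ Q → AtMost k Q → AtMost k P
AtMost-mono P⊆Q atMost uniq pxs = atMost uniq (All.map P⊆Q pxs)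

AtMost-∪ : Decidable P → AtMost a P → AtMost b Q → AtMost (a + b) (P ∪ Q)
AtMost-∪ {P = P} {a = a} {b = b} {Q = Q} P? atMostP atMostQ {xs} uniq pqxs = begin
  length xs                                          ≡⟨ length-filter+length-filter-∁ P? xs ⟨
  length (filter P? xs) + length (filter (∁? P?) xs) ≤⟨ +-mono-≤ (atMostP (Unique.filter⁺ P? uniq) accepted)
                                                                (atMostQ (Unique.filter⁺ (∁? P?) uniq) rejected) ⟩
  a + b                                              ∎
  where
    open ≤-Reasoning
    accepted : All P (filter P? xs)
    accepted = All.all-filter P? xs
    rejected : All Q (filter (∁? P?) xs)
    rejected = All.zipWith (λ { (¬p , inj₁ p) → contradiction p ¬p ; (_ , inj₂ q) → q })
      (All.all-filter (∁? P?) xs , All.filter⁺ (∁? P?) pqxs)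

module GreedyColouring {V : Set} (Clash : Rel V 0ℓ) (Clash? : Decidable₂ Clash) (P : Pred V 0ℓ) (Δ : ℕ)
  (degree≤Δ : ∀ {x} → P x → AtMost Δ (λ y → P y × x ≢ y × Clash x y)) where

  Colour : Set
  Colour = Fin (suc Δ)

  ProperPair : Rel (V × Colour) 0ℓ
  ProperPair (x , i) (y , j) = i ≡ j → ¬ Clash x y

  greedy : ∀ xs → Unique xs → All P xs →
    Σ (List (V × Colour)) λ κ → map proj₁ κ ≡ xs × AllPairs ProperPair κ
  greedy []       []           []         = [] , refl , []
  greedy (x ∷ xs) (x∉xs ∷ uniq) (px ∷ pxs) with greedy xs uniq pxs
  ... | κ , refl , proper = (x , colour) ∷ κ , refl , avoids ∷ proper
    where
      clashing : List (V × Colour)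
      clashing = filter (Clash? x ∘ proj₁) κ

      neighbours : All (λ y → P y × x ≢ y × Clash x y) (map proj₁ clashing)
      neighbours = All.map⁺ (All.tabulate λ a∈ →
        let (a∈κ , clash) = ∈-filter⁻ (Clash? x ∘ proj₁) a∈
        in All.lookup (All.map⁻ pxs) a∈κ , All.lookup (All.map⁻ x∉xs) a∈κ , clash)

      clashing-unique : Unique (map proj₁ clashing)
      clashing-unique = AllPairs.map⁺ (AllPairs.filter⁺ (Clash? x ∘ proj₁) (AllPairs.map⁻ uniq))

      fewUsed : length (map proj₂ clashing) < suc Δ
      fewUsed = s≤s (begin
        length (map proj₂ clashing) ≡⟨ length-map proj₂ clashing ⟩
        length clashing             ≡⟨ length-map proj₁ clashing ⟨
        length (map proj₁ clashing) ≤⟨ degree≤Δ px clashing-unique neighbours ⟩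
        Δ                           ∎)
        where open ≤-Reasoning

      colour : Colour
      colour = proj₁ (∃∉ (map proj₂ clashing) fewUsed)

      colour∉used : colour ∉ map proj₂ clashing
      colour∉used = proj₂ (∃∉ (map proj₂ clashing) fewUsed)

      avoids : All (ProperPair (x , colour)) κ
      avoids = All.tabulate λ y∈κ colour≡j clash → colour∉used (subst (_∈ map proj₂ clashing) (sym colour≡j)
        (∈-map⁺ proj₂ (∈-filter⁺ (Clash? x ∘ proj₁) y∈κ clash)))

  colourable : ∀ xs → Unique xs → All P xs →
    Σ (Colour → List V) λ class →
      (∀ i → AllPairs (λ x y → ¬ Clash x y) (class i)) × (∀ {x} → x ∈ xs → ∃ λ i → x ∈ class i)
  colourable xs uniq pxs with greedy xs uniq pxs
  ... | κ , refl , proper = class , clashFree , covered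
    where
      hasColour? : ∀ i → Decidable (λ (a : V × Colour) → proj₂ a ≡ i)
      hasColour? i a = proj₂ a ≟ᶠ i

      class : Colour → List V
      class i = map proj₁ (filter (hasColour? i) κ)

      clashFree : ∀ i → AllPairs (λ x y → ¬ Clash x y) (class i)
      clashFree i = AllPairs.map⁺ (AllPairs-mapWith (λ { refl refl p → p refl })
        (All.all-filter (hasColour? i) κ) (AllPairs.filter⁺ (hasColour? i) proper))

      covered : ∀ {x} → x ∈ map proj₁ κ → ∃ λ i → x ∈ class i
      covered x∈ with ∈-map⁻ proj₁ x∈
      ... | (y , i) , a∈κ , refl = i , ∈-map⁺ proj₁ (∈-filter⁺ (hasColour? i) a∈κ refl)

_≟ᶜ_ : DecidableEquality (Cell n)
_≟ᶜ_ = ≡-dec _≟ᶠ_ _≟ᶠ_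

module _ {n : ℕ} (L : LatinSquare n) where

  SharesLine : Rel (Cell n) 0ℓ
  SharesLine x y = row x ≡ row y ⊎ col x ≡ col y ⊎ symbol L x ≡ symbol L y

  sharesLine? : Decidable₂ SharesLine
  sharesLine? x y = row x ≟ᶠ row y ⊎-dec (col x ≟ᶠ col y ⊎-dec symbol L x ≟ᶠ symbol L y)

  clashFree⇒partialTransversal : ∀ {T} → AllPairs (λ x y → ¬ SharesLine x y) T → IsPartialTransversal L T
  clashFree⇒partialTransversal clashFree =
    AllPairs.map⁺ (AllPairs.map (_∘ inj₁) clashFree) ,
    AllPairs.map⁺ (AllPairs.map (_∘ inj₂ ∘ inj₁) clashFree) ,
    AllPairs.map⁺ (AllPairs.map (_∘ inj₂ ∘ inj₂) clashFree)

  module DisjointTransversals (Ts : List (List (Cell n)))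
    (transversal : All (IsTransversal L) Ts) (disjoint : AllPairs Disjoint Ts) where

    Covered : Pred (Cell n) 0ℓ
    Covered x = Any (x ∈_) Ts

    covered? : Decidable Covered
    covered? x = Any.any? (DecMembership._∈?_ _≟ᶜ_ x) Ts

    t : ℕ
    t = length Ts

    LineMate : (Cell n → Fin n) → Cell n → Pred (Cell n) 0ℓ
    LineMate p x y = ¬ Covered y × x ≢ y × p x ≡ p y

    lineMate? : ∀ p x → Decidable (LineMate p x)
    lineMate? p x y = ¬? (covered? y) ×-dec (¬? (x ≟ᶜ y) ×-dec (p x ≟ᶠ p y))

    -- The lines {y ∣ p y ≡ v} of one direction of the square, on which q is a coordinate.
    module Line (p q : Cell n → Fin n)
      (transversal-unique : ∀ {T} → IsTransversal L T → Unique (map p T))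
      (coordinate : ∀ {x y} → p x ≡ p y → q x ≡ q y → x ≡ y) where

      transversal-meets : ∀ {T} → IsTransversal L T → ∀ v → ∃ λ c → c ∈ T × v ≡ p c
      transversal-meets {T} isT v = ∈-map⁻ p
        (Unique∧length≡⇒∈ (transversal-unique isT) (trans (length-map p T) (proj₂ isT)) v)

      meetings : ∀ {Us} → All (IsTransversal L) Us → AllPairs Disjoint Us → ∀ v →
        Σ (List (Cell n)) λ cs →
          length cs ≡ length Us × Unique cs × All (λ c → v ≡ p c) cs × All (λ c → Any (c ∈_) Us) cs
      meetings []           []              v = [] , refl , [] , [] , []
      meetings (isT ∷ isTs) (disjT ∷ disjUs) v with transversal-meets isT v | meetings isTs disjUs v
      ... | c , c∈T , onLine | cs , |cs| , uniq , onLines , inUs =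
        c ∷ cs , cong suc |cs| , All.map c∉Us inUs ∷ uniq , onLine ∷ onLines , here c∈T ∷ All.map there inUs
        where
          c∉Us : ∀ {c′} → Any (c′ ∈_) _ → c ≢ c′
          c∉Us c′∈Us refl = All.lookupWith (λ disj c∈U → disj c c∈T c∈U) disjT c′∈Us

      -- Each of the t transversals meets the line through x in a covered cell, and these,
      -- x and its uncovered line mates are distinct cells of one line.
      lineMates-atMost : ∀ {x} → ¬ Covered x → AtMost (n ∸ suc t) (LineMate p x)
      lineMates-atMost {x} x-uncovered {ys} uniq mates with meetings transversal disjoint (p x)
      ... | cs , |cs| , cs-unique , onLine , cs-covered = m+n≤o⇒m≤o∸n (length ys) (begin
        length ys + suc t            ≡⟨ +-comm (length ys) (suc t) ⟩
        suc t + length ys            ≡⟨ cong (λ l → suc l + length ys) |cs| ⟨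
        suc (length cs + length ys)  ≡⟨ +-suc (length cs) (length ys) ⟨
        length cs + length (x ∷ ys)  ≡⟨ length-++ cs ⟨
        length line                  ≡⟨ length-map q line ⟨
        length (map q line)          ≤⟨ Unique⇒length≤ q-unique ⟩
        n                            ∎)
        where
          open ≤-Reasoning
          line : List (Cell n)
          line = cs ++ x ∷ ys

          line-on : All (λ c → p x ≡ p c) line
          line-on = All.++⁺ onLine (refl ∷ All.map (proj₂ ∘ proj₂) mates)

          line-unique : Unique line
          line-unique = Unique.++⁺ cs-unique (All.map (proj₁ ∘ proj₂) mates ∷ uniq)
            λ (c∈cs , c∈xys) →
              All.lookup (x-uncovered ∷ All.map proj₁ mates) c∈xys (All.lookup cs-covered c∈cs)

          q-unique : Unique (map q line)
          q-unique = AllPairs.map⁺ (AllPairs-mapWith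
            (λ pc pd c≢d qc≡qd → c≢d (coordinate (trans (sym pc) pd) qc≡qd)) line-on line-unique)

    d : ℕ
    d = n ∸ suc t

    symbol-col-coordinate : ∀ {x y} → symbol L x ≡ symbol L y → col x ≡ col y → x ≡ y
    symbol-col-coordinate {r , c} {r′ , .c} same-symbol refl = cong (_, c) (colInj L c same-symbol)

    open Line row col (proj₁ ∘ proj₁) (λ r c → ×-≡,≡→≡ (r , c))
      using () renaming (lineMates-atMost to rowMates-atMost)
    open Line col row (proj₁ ∘ proj₂ ∘ proj₁) (λ c r → ×-≡,≡→≡ (r , c))
      using () renaming (lineMates-atMost to colMates-atMost)
    open Line (symbol L) col (proj₂ ∘ proj₂ ∘ proj₁) symbol-col-coordinate
      using () renaming (lineMates-atMost to symbolMates-atMost)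

    Neighbour : Cell n → Pred (Cell n) 0ℓ
    Neighbour x y = ¬ Covered y × x ≢ y × SharesLine x y

    neighbours-atMost : ∀ {x} → ¬ Covered x → AtMost (d + (d + d)) (Neighbour x)
    neighbours-atMost {x} x-uncovered = AtMost-mono byLine
      (AtMost-∪ (lineMate? row x) (rowMates-atMost x-uncovered)
        (AtMost-∪ (lineMate? col x) (colMates-atMost x-uncovered) (symbolMates-atMost x-uncovered)))
      where
        byLine : Neighbour x ⊆ LineMate row x ∪ (LineMate col x ∪ LineMate (symbol L) x)
        byLine (u , x≢y , inj₁ r)        = inj₁ (u , x≢y , r)
        byLine (u , x≢y , inj₂ (inj₁ c)) = inj₂ (inj₁ (u , x≢y , c))
        byLine (u , x≢y , inj₂ (inj₂ s)) = inj₂ (inj₂ (u , x≢y , s))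

    open GreedyColouring SharesLine sharesLine? (∁ Covered) (d + (d + d)) neighbours-atMost

    uncoveredCells : List (Cell n)
    uncoveredCells = filter (∁? covered?) (cartesianProduct (allFin n) (allFin n))

    transversals+colourClasses-cover : CoverableBy L (t + suc (d + (d + d)))
    transversals+colourClasses-cover with colourable uncoveredCells
      (Unique.filter⁺ (∁? covered?) (Unique.cartesianProduct⁺ (Unique.allFin⁺ n) (Unique.allFin⁺ n)))
      (All.all-filter (∁? covered?) (cartesianProduct (allFin n) (allFin n)))
    ... | class , clashFree , classified =
      Ts ++ tabulate class ,
      trans (length-++ Ts) (cong (t +_) (length-tabulate class)) ,
      All.++⁺ (All.map proj₁ transversal) (All.tabulate⁺ (clashFree⇒partialTransversal ∘ clashFree)) ,
      covers
      where
        covers : ∀ x → Any (x ∈_) (Ts ++ tabulate class)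
        covers x with covered? x
        ... | yes x-covered   = Any.++⁺ˡ x-covered
        ... | no  x-uncovered =
          let (i , x∈class) = classified (∈-filter⁺ (∁? covered?)
                                (∈-cartesianProduct⁺ (∈-allFin (row x)) (∈-allFin (col x))) x-uncovered)
          in Any.++⁺ʳ Ts (Any.tabulate⁺ {f = class} i x∈class)

coverable : ∀ {n t} (L : LatinSquare n) → HasDisjointTransversals L t →
  CoverableBy L (t + suc (3 * (n ∸ suc t)))
coverable {n} {t} L (Ts , refl , transversal , disjoint) =
  subst (λ e → CoverableBy L (t + suc (d + (d + e)))) (sym (+-identityʳ d))
    (DisjointTransversals.transversals+colourClasses-cover L Ts transversal disjoint)
  where
    d : ℕ
    d = n ∸ suc t

coverable⇒n≤ : ∀ {n k} (L : LatinSquare n) → CoverableBy L k → n ≤ k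
coverable⇒n≤ {zero}  L _                              = z≤n
coverable⇒n≤ {suc n} L (Ts , refl , partial , covers) = injective⇒≤ coveringIndex-injective
  where
    coveringIndex : Fin (suc n) → Fin (length Ts)
    coveringIndex c = Any.index (covers (zero , c))

    coveringIndex-injective : Injective _≡_ _≡_ coveringIndex
    coveringIndex-injective {a} {b} same = cong proj₂ (Unique-map⇒injectiveOn
      (proj₁ (All.lookup partial (∈-lookup (coveringIndex b))))
      (subst (λ i → (zero , a) ∈ lookup Ts i) same (Any.lookup-index (covers (zero , a))))
      (Any.lookup-index (covers (zero , b)))
      refl)

hasDisjointTransversals-≤ : ∀ {n m k} (L : LatinSquare n) → m ≤ k →
  HasDisjointTransversals L k → HasDisjointTransversals L m
hasDisjointTransversals-≤ {m = m} L m≤k (Ts , refl , transversal , disjoint) =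
  take m Ts , trans (length-take m Ts) (m≤n⇒m⊓n≡m m≤k) ,
  All.take⁺ m transversal , AllPairs.take⁺ m disjoint

colourCount : ∀ {n t} → t < n → t + suc (3 * (n ∸ suc t)) ≡ 3 * n ∸ 2 * t ∸ 2
colourCount {n} {t} t<n = begin
  t + suc (3 * d)                          ≡⟨ m+n∸n≡m (t + suc (3 * d)) 2 ⟨
  t + suc (3 * d) + 2 ∸ 2                  ≡⟨ cong (_∸ 2) (m+n∸n≡m (t + suc (3 * d) + 2) (2 * t)) ⟨
  t + suc (3 * d) + 2 + 2 * t ∸ 2 * t ∸ 2  ≡⟨ cong (λ e → e ∸ 2 * t ∸ 2) (expand t d) ⟨
  3 * (suc t + d) ∸ 2 * t ∸ 2              ≡⟨ cong (λ e → 3 * e ∸ 2 * t ∸ 2) (m+[n∸m]≡n t<n) ⟩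
  3 * n ∸ 2 * t ∸ 2                        ∎
  where
    open ≡-Reasoning
    d : ℕ
    d = n ∸ suc t
    expand : ∀ t d → 3 * (suc t + d) ≡ t + suc (3 * d) + 2 + 2 * t
    expand = solve-∀

mainTheorem3 : (n : ℕ) (L : LatinSquare n) (t χ : ℕ) →
    IsMaxDisjointTransversals L t → IsChi L χ →
    (t ≤ n ∸ 2 → χ ≤ 3 * n ∸ 2 * t ∸ 2) × (¬ (t ≤ n ∸ 2) → χ ≡ n)
mainTheorem3 zero L t χ _ (_ , minimal) = (λ _ → ≤-trans χ≤0 z≤n) , (λ _ → n≤0⇒n≡0 χ≤0)
  where
    χ≤0 : χ ≤ 0
    χ≤0 = minimal 0 ([] , refl , [] , λ ())
mainTheorem3 (suc m) L t χ (t-disjoint , _) (χ-cover , minimal) = fewTransversals , manyTransversals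
  where
    fewTransversals : t ≤ suc m ∸ 2 → χ ≤ 3 * suc m ∸ 2 * t ∸ 2
    fewTransversals t≤n-2 = subst (χ ≤_) (colourCount (s≤s (≤-trans t≤n-2 (m∸n≤m m 1))))
      (minimal _ (coverable L t-disjoint))

    pred≤t : ∀ k → ¬ (t ≤ suc k ∸ 2) → k ≤ t
    pred≤t zero    _     = z≤n
    pred≤t (suc _) t≰k-1 = ≰⇒> t≰k-1

    manyTransversals : ¬ (t ≤ suc m ∸ 2) → χ ≡ suc m
    manyTransversals t≰n-2 = ≤-antisym
      (subst (χ ≤_) (trans (cong (λ e → m + suc (3 * e)) (n∸n≡0 m)) (+-comm m 1))
        (minimal _ (coverable L (hasDisjointTransversals-≤ L (pred≤t m t≰n-2) t-disjoint))))
      (coverable⇒n≤ L χ-cover)
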